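{- For every integer $n\ge 0$ and every $i\in\{ -1,0,1\}$, one has $L(\tilde e(n,i,0))\in \mathrm{CH}_2^+$.
   Context: Let $\mathrm{CH}_2$ be the commutative ring which is a free $\mathbb{Z}$-module with basis $\{h_i : i\ge 0\}$ and multiplication $h_ih_j=\sum_{k=0}^{\min(i,j)}h_{i+j-2k}$. Let $\mathrm{CH}_2^+\subset \mathrm{CH}_2$ be the set of finite sums $\sum_{i\ge 0}c_ih_i$ with all $c_i\in\mathbb{Z}_{\ge 0}$. Let $\tilde{\mathrm{CH}}_2$ be the free $\mathbb{Z}$-module with basis $\{\tilde h_i : i\in\mathbb{Z}\}$. The ring $\mathrm{CH}_2$ acts on $\tilde{\mathrm{CH}}_2$ on the left by $h_i\tilde h_j=\sum_{k=0}^{i}\tilde h_{j-i+2k}$ ($i\ge 0$, $j\in\mathbb{Z}$), extended bilinearly. Let $L:\tilde{\mathrm{CH}}_2\to \mathrm{CH}_2$ be the $\mathbb{Z}$-linear map with $L(\tilde h_{ -1})=0$, $L(\tilde h_i)=h_i$ for $i\ge 0$, and $L(\tilde h_i)=-h_{ -i-2}$ for $i\le -2$. The (associative, non-commutative) product on $\tilde{\mathrm{CH}}_2$ is $g_1g_2:=L(g_1)\,g_2$ (left action); products of several factors and powers $g^2=gg$ are taken in this ring. For $i\in\mathbb{Z}$, $S_i$ denotes the $\mathbb{Z}$-linear map $\tilde{\mathrm{CH}}_2\to\tilde{\mathrm{CH}}_2$ with $S_i(\tilde h_j)=\tilde h_{j+i}$. Define elements $\tilde e(n,i,0)\in\tilde{\mathrm{CH}}_2$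 for $n\ge 0$, $i\in\{ -1,0,1\}$ recursively by $\tilde e(0,0,0)=\tilde h_2$, $\tilde e(0,1,0)=\tilde h_1$, $\tilde e(0,-1,0)=\tilde h_1$, and for $n\ge 0$: $\tilde e(n+1,0,0)=\tilde e(n,0,0)\big(\tilde e(n,0,0)^2-\tilde e(n,1,0)^2\big)$, $\tilde e(n+1,1,0)=\tilde e(n,1,0)\tilde e(n,0,0)\tilde e(n,0,0)+\tilde e(n,0,0)\tilde e(n,0,0)\tilde e(n,1,0)-\tilde e(n,1,0)\tilde h_1\tilde e(n,0,0)\tilde e(n,1,0)$, $\tilde e(n+1,-1,0)=\tilde e(n,1,0)\tilde e(n,0,0)\tilde e(n,0,0)+\tilde e(n,0,0)\tilde e(n,0,0)\tilde e(n,1,0)-\tilde e(n,1,0)\tilde h_1\tilde e(n,0,0)\tilde e(n,1,0)+\tilde e(n,-1,0)^2\big(\tilde e(n,-1,0)-\tilde e(n,1,0)\big)$. -}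

module Defs where

open import Data.Nat as ℕ using (ℕ; zero; suc)
open import Data.Integer as ℤ using (ℤ; +_; -[1+_]; _≤_)
open import Data.List using (List; []; _∷_; _++_; map; concatMap; upTo)
open import Data.Product using (_×_; _,_)
open import Data.Bool using (if_then_else_)

-- Elements of CH₂ as formal finite sums Σ c · h_i, given as lists of (i , c).
CH₂ : Set
CH₂ = List (ℕ × ℤ)

-- Elements of CH̃₂ as formal finite sums Σ c · h̃_j, given as lists of (j , c).
CH̃₂ : Set
CH̃₂ = List (ℤ × ℤ)

coeff : CH₂ → ℕ → ℤ
coeff [] k = + 0
coeff ((i , c) ∷ xs) k = if i ℕ.≡ᵇ k then c ℤ.+ coeff xs k else coeff xs k

InCH₂⁺ : CH₂ → Set
InCH₂⁺ x = ∀ k → + 0 ≤ coeff x k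

h̃ : ℤ → CH̃₂
h̃ j = (j , + 1) ∷ []

scale : ℤ → CH̃₂ → CH̃₂
scale a = map (λ { (j , c) → (j , a ℤ.* c) })

_⊕_ : CH̃₂ → CH̃₂ → CH̃₂
_⊕_ = _++_

_⊖_ : CH̃₂ → CH̃₂ → CH̃₂
g ⊖ g' = g ++ scale (ℤ.- (+ 1)) g'

-- h_i · h̃_j = Σ_{k=0}^{i} h̃_{j-i+2k}
actBasis : ℕ → ℤ → CH̃₂
actBasis i j = map (λ k → ((j ℤ.- + i) ℤ.+ (+ 2) ℤ.* (+ k) , + 1)) (upTo (suc i))

act : CH₂ → CH̃₂ → CH̃₂
act x g = concatMap (λ { (i , a) → concatMap (λ { (j , b) → scale (a ℤ.* b) (actBasis i j) }) g }) x

Lterm : ℤ × ℤ → CH₂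
Lterm (+ n , c) = (n , c) ∷ []
Lterm (-[1+ zero ] , c) = []
Lterm (-[1+ suc m ] , c) = (m , ℤ.- c) ∷ []   -- index -(m+2) ↦ -h_m

L : CH̃₂ → CH₂
L = concatMap Lterm

_·_ : CH̃₂ → CH̃₂ → CH̃₂
g₁ · g₂ = act (L g₁) g₂
infixr 7 _·_
infixl 6 _⊕_ _⊖_

data Idx : Set where
  m1 z p1 : Idx

record Triple : Set where
  constructor triple
  field e0 e1 em1 : CH̃₂   -- ẽ(n,0,0), ẽ(n,1,0), ẽ(n,-1,0)

step : Triple → Triple
step (triple e0 e1 em1) = triple
  (e0 · (e0 · e0 ⊖ e1 · e1))
  (common)
  (common ⊕ em1 · em1 · (em1 ⊖ e1))
  where
  common : CH̃₂
  common = e1 · e0 · e0 ⊕ e0 · e0 · e1 ⊖ e1 · h̃ (+ 1) · e0 · e1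

ẽs : ℕ → Triple
ẽs zero = triple (h̃ (+ 2)) (h̃ (+ 1)) (h̃ (+ 1))
ẽs (suc n) = step (ẽs n)

ẽ : ℕ → Idx → CH̃₂
ẽ n z = Triple.e0 (ẽs n)
ẽ n p1 = Triple.e1 (ẽs n)
ẽ n m1 = Triple.em1 (ẽs n)

-- Let h_n act on functions f : ℤ → ℤ by f ↦ (s ↦ Σₖ₌₀ⁿ f (s - n + 2k)) and h̃_j by the same sum
-- with the signs of L. Then g₁g₂ = L(g₁)g₂ acts as the composite of the actions, so CH̃₂, with
-- elements identified when they act alike, is a commutative ring. In it the recursion factorises:
-- ẽ(n,0,0) ≈ Gₙ h_{2ⁿ⁺¹} and ẽ(n,±1,0) ≈ Gₙ h_{2ⁿ⁺¹-1}, with G₀ = h₀ and Gₙ₊₁ = Gₙ³ h_{2ⁿ⁺¹}.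
-- Indeed the extra term of ẽ(n+1,-1,0) vanishes since ẽ(n,-1,0) ≈ ẽ(n,1,0), and what remains
-- reduces to h_{m+1}² - h_m² = h_{2m+2} and 2 h_m h_{m+1} - h_m h₁ h_m = h_{2m+1}. By Clebsch-Gordan
-- every product of h's is a sum of h̃_k with k ≥ 0, hence so is ẽ(n,i,0). Finally the coefficient
-- of h_k in L(g) is the action of g on δ = 𝟙₁ - 𝟙₋₁ evaluated at k + 1, nonnegative for such sums.

module Submission where

open import Algebra.Bundles using (CommutativeRing)
open import Data.Bool using (true; false; if_then_else_)
open import Data.Integer as ℤ using (ℤ; +_; -[1+_]; _+_; _*_; -_; _-_; _≤_)
import Data.Integer.Properties as ℤₚ
open import Algebra.Properties.CommutativeSemigroup ℤₚ.+-commutativeSemigroup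
  using (interchange; x∙yz≈y∙xz)
open import Data.Integer.Tactic.RingSolver using (solve-∀)
open import Data.List using (List; []; _∷_; _++_; map; concatMap; applyUpTo)
import Data.List.Properties as Listₚ
open import Data.Maybe using (nothing)
open import Data.Nat as ℕ using (ℕ; zero; suc)
import Data.Nat.Properties as ℕₚ
open import Data.Product using (_×_; _,_; ∃-syntax)
open import Data.Sum using (inj₁; inj₂)
open import Function using (_∘_; mk⇔)
open import Relation.Binary.PropositionalEquality
import Relation.Binary.Reasoning.Setoid
open import Relation.Nullary using (does)
open import Relation.Nullary.Decidable using (does-⇔)
open import Tactic.RingSolver using () renaming (solve-∀ to ring-solve)
open import Tactic.RingSolver.Core.AlmostCommutativeRing
  using (AlmostCommutativeRing; fromCommutativeRing)

open import Defs

-- Chebyshev-type sums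

Fun : Set
Fun = ℤ → ℤ

-- σ n f s = Σₖ₌₀ⁿ f (s - n + 2k)
σ : ℕ → Fun → Fun
σ zero    f s = f s
σ (suc n) f s = f (s - + suc n) + σ n f (s + + 1)

σ-cong : ∀ n {f g : Fun} → (∀ u → f u ≡ g u) → ∀ s → σ n f s ≡ σ n g s
σ-cong zero    f≗g s = f≗g s
σ-cong (suc n) f≗g s = cong₂ _+_ (f≗g _) (σ-cong n f≗g _)

σ-+ : ∀ n (f g : Fun) s → σ n (λ u → f u + g u) s ≡ σ n f s + σ n g s
σ-+ zero    f g s = refl
σ-+ (suc n) f g s rewrite σ-+ n f g (s + + 1) =
  interchange (f (s - + suc n)) (g (s - + suc n)) (σ n f (s + + 1)) (σ n g (s + + 1))

σ-scale : ∀ n c (f : Fun) s → σ n (λ u → c * f u) s ≡ c * σ n f s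
σ-scale zero    c f s = refl
σ-scale (suc n) c f s rewrite σ-scale n c f (s + + 1) = sym (ℤₚ.*-distribˡ-+ c _ _)

σ-neg : ∀ n (f : Fun) s → σ n (λ u → - f u) s ≡ - σ n f s
σ-neg zero    f s = refl
σ-neg (suc n) f s rewrite σ-neg n f (s + + 1) = sym (ℤₚ.neg-distrib-+ (f (s - + suc n)) (σ n f (s + + 1)))

σ-zero : ∀ n s → σ n (λ _ → + 0) s ≡ + 0
σ-zero zero    s = refl
σ-zero (suc n) s rewrite σ-zero n (s + + 1) = refl

σ-shift : ∀ n c (f : Fun) s → σ n (λ u → f (u + c)) s ≡ σ n f (s + c)
σ-shift zero    c f s = refl
σ-shift (suc n) c f s =
  cong₂ _+_ (cong f (e₁ s (+ suc n) c)) (trans (σ-shift n c f _) (cong (σ n f) (e₂ s c)))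
  where
  e₁ : ∀ s i c → s - i + c ≡ s + c - i
  e₁ = solve-∀
  e₂ : ∀ s c → s + + 1 + c ≡ s + c + + 1
  e₂ = solve-∀

σ-comm : ∀ m n (f : Fun) s → σ m (σ n f) s ≡ σ n (σ m f) s
σ-comm zero    n f s = refl
σ-comm (suc m) n f s = sym (begin
  σ n (λ u → f (u - + suc m) + σ m f (u + + 1)) s
    ≡⟨ σ-+ n _ _ s ⟩
  σ n (λ u → f (u - + suc m)) s + σ n (λ u → σ m f (u + + 1)) s
    ≡⟨ cong₂ _+_ (σ-shift n (- + suc m) f s) (σ-shift n (+ 1) (σ m f) s) ⟩
  σ n f (s - + suc m) + σ n (σ m f) (s + + 1)
    ≡⟨ cong (_+_ (σ n f (s - + suc m))) (σ-comm m n f (s + + 1)) ⟨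
  σ n f (s - + suc m) + σ m (σ n f) (s + + 1) ∎)
  where open ≡-Reasoning

σ-last : ∀ n (f : Fun) s → σ (suc n) f s ≡ σ n f (s - + 1) + f (s + + suc n)
σ-last zero    f s = refl
σ-last (suc n) f s = begin
  f (s - + suc (suc n)) + σ (suc n) f (s + + 1)
    ≡⟨ cong (_+_ (f (s - + suc (suc n)))) (σ-last n f (s + + 1)) ⟩
  f (s - + suc (suc n)) + (σ n f (s + + 1 - + 1) + f (s + + 1 + + suc n))
    ≡⟨ cong₂ (λ a b → f (s - + suc (suc n)) + (σ n f a + f b)) (e₁ s) (e₂ s (+ n)) ⟩
  f (s - + suc (suc n)) + (σ n f (s - + 1 + + 1) + f (s + + suc (suc n)))
    ≡⟨ ℤₚ.+-assoc (f (s - + suc (suc n))) _ _ ⟨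
  f (s - + suc (suc n)) + σ n f (s - + 1 + + 1) + f (s + + suc (suc n))
    ≡⟨ cong (λ a → f a + σ n f (s - + 1 + + 1) + f (s + + suc (suc n))) (e₃ s (+ n)) ⟩
  f (s - + 1 - + suc n) + σ n f (s - + 1 + + 1) + f (s + + suc (suc n)) ∎
  where
  open ≡-Reasoning
  e₁ : ∀ s → s + + 1 - + 1 ≡ s - + 1 + + 1
  e₁ = solve-∀
  e₂ : ∀ s n → s + + 1 + (+ 1 + n) ≡ s + (+ 1 + (+ 1 + n))
  e₂ = solve-∀
  e₃ : ∀ s n → s - (+ 1 + (+ 1 + n)) ≡ s - + 1 - (+ 1 + n)
  e₃ = solve-∀

-- Negative indices follow the sign convention of L.
σ̃ : ℤ → Fun → Fun
σ̃ (+ n) = σ n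
σ̃ -[1+ zero ] f s = + 0
σ̃ -[1+ suc m ] f s = - σ m f s

σ̃-cong : ∀ j {f g : Fun} → (∀ u → f u ≡ g u) → ∀ s → σ̃ j f s ≡ σ̃ j g s
σ̃-cong (+ n) f≗g s = σ-cong n f≗g s
σ̃-cong -[1+ zero ] f≗g s = refl
σ̃-cong -[1+ suc m ] f≗g s = cong -_ (σ-cong m f≗g s)

σ̃-+ : ∀ j (f g : Fun) s → σ̃ j (λ u → f u + g u) s ≡ σ̃ j f s + σ̃ j g s
σ̃-+ (+ n) f g s = σ-+ n f g s
σ̃-+ -[1+ zero ] f g s = refl
σ̃-+ -[1+ suc m ] f g s = trans (cong -_ (σ-+ m f g s)) (ℤₚ.neg-distrib-+ (σ m f s) (σ m g s))

σ̃-scale : ∀ j c (f : Fun) s → σ̃ j (λ u → c * f u) s ≡ c * σ̃ j f s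
σ̃-scale (+ n) c f s = σ-scale n c f s
σ̃-scale -[1+ zero ] c f s = sym (ℤₚ.*-zeroʳ c)
σ̃-scale -[1+ suc m ] c f s = trans (cong -_ (σ-scale m c f s)) (ℤₚ.neg-distribʳ-* c (σ m f s))

σ̃-neg : ∀ j (f : Fun) s → σ̃ j (λ u → - f u) s ≡ - σ̃ j f s
σ̃-neg (+ n) f s = σ-neg n f s
σ̃-neg -[1+ zero ] f s = refl
σ̃-neg -[1+ suc m ] f s = cong -_ (σ-neg m f s)

σ̃-zero : ∀ j s → σ̃ j (λ _ → + 0) s ≡ + 0
σ̃-zero (+ n) s = σ-zero n s
σ̃-zero -[1+ zero ] s = refl
σ̃-zero -[1+ suc m ] s = cong -_ (σ-zero m s)

σ-σ̃-comm : ∀ n j (f : Fun) s → σ n (σ̃ j f) s ≡ σ̃ j (σ n f) s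
σ-σ̃-comm n (+ m) f s = σ-comm n m f s
σ-σ̃-comm n -[1+ zero ] f s = σ-zero n s
σ-σ̃-comm n -[1+ suc m ] f s = trans (σ-neg n (σ m f) s) (cong -_ (σ-comm n m f s))

σ̃-comm : ∀ i j (f : Fun) s → σ̃ i (σ̃ j f) s ≡ σ̃ j (σ̃ i f) s
σ̃-comm (+ n) j f s = σ-σ̃-comm n j f s
σ̃-comm -[1+ zero ] j f s = sym (σ̃-zero j s)
σ̃-comm -[1+ suc m ] j f s = trans (cong -_ (σ-σ̃-comm m j f s)) (sym (σ̃-neg j (σ m f) s))

σ̃-unfold : ∀ j (f : Fun) u → σ̃ j f u ≡ f (u - j) + σ̃ (j - + 1) f (u + + 1)
σ̃-unfold (+ zero) f u = trans (cong f (sym (ℤₚ.+-identityʳ u))) (sym (ℤₚ.+-identityʳ _))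
σ̃-unfold (+ suc n) f u = refl
σ̃-unfold -[1+ zero ] f u = sym (ℤₚ.+-inverseʳ (f (u + + 1)))
σ̃-unfold -[1+ suc m ] f u = begin
  - σ m f u
    ≡⟨ e₁ (f (u + + suc (suc m))) (σ m f u) ⟩
  f (u + + suc (suc m)) + - (σ m f u + f (u + + suc (suc m)))
    ≡⟨ cong (λ a → f (u + + suc (suc m)) + - a) (trans (σ-last m f (u + + 1))
         (cong₂ _+_ (cong (σ m f) (e₂ u)) (cong f (e₃ u (+ m))))) ⟨
  f (u + + suc (suc m)) + - σ (suc m) f (u + + 1)
    ≡⟨ cong (λ k → f (u + + suc (suc m)) + - σ (suc k) f (u + + 1)) (ℕₚ.+-identityʳ m) ⟨
  f (u - -[1+ suc m ]) + σ̃ (-[1+ suc m ] - + 1) f (u + + 1) ∎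
  where
  open ≡-Reasoning
  e₁ : ∀ a b → - b ≡ a + - (b + a)
  e₁ = solve-∀
  e₂ : ∀ u → u + + 1 - + 1 ≡ u
  e₂ = solve-∀
  e₃ : ∀ u m → u + + 1 + (+ 1 + m) ≡ u + (+ 1 + (+ 1 + m))
  e₃ = solve-∀

σ̃-unfold⁺ : ∀ i j (f : Fun) s →
            σ̃ j f (s - + suc i) ≡ σ̃ (j - + suc i) f s + σ i (λ u → f (u - (j + + 1))) s
σ̃-unfold⁺ zero j f s = begin
  σ̃ j f (s - + 1)
    ≡⟨ σ̃-unfold j f (s - + 1) ⟩
  f (s - + 1 - j) + σ̃ (j - + 1) f (s - + 1 + + 1)
    ≡⟨ cong₂ _+_ (cong f (e₁ s j)) (cong (σ̃ (j - + 1) f) (e₂ s)) ⟩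
  f (s - (j + + 1)) + σ̃ (j - + 1) f s
    ≡⟨ ℤₚ.+-comm (f (s - (j + + 1))) (σ̃ (j - + 1) f s) ⟩
  σ̃ (j - + 1) f s + f (s - (j + + 1)) ∎
  where
  open ≡-Reasoning
  e₁ : ∀ s j → s - + 1 - j ≡ s - (j + + 1)
  e₁ = solve-∀
  e₂ : ∀ s → s - + 1 + + 1 ≡ s
  e₂ = solve-∀
σ̃-unfold⁺ (suc i) j f s = begin
  σ̃ j f (s - + suc (suc i))
    ≡⟨ σ̃-unfold j f _ ⟩
  f (s - + suc (suc i) - j) + σ̃ (j - + 1) f (s - + suc (suc i) + + 1)
    ≡⟨ cong (λ a → f (s - + suc (suc i) - j) + σ̃ (j - + 1) f a) (e₁ s (+ i)) ⟩
  f (s - + suc (suc i) - j) + σ̃ (j - + 1) f (s - + suc i)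
    ≡⟨ cong (_+_ (f (s - + suc (suc i) - j))) (σ̃-unfold⁺ i (j - + 1) f s) ⟩
  f (s - + suc (suc i) - j) + (σ̃ (j - + 1 - + suc i) f s + σ i (λ u → f (u - (j - + 1 + + 1))) s)
    ≡⟨ cong₂ (λ a k → f a + (σ̃ k f s + σ i (λ u → f (u - (j - + 1 + + 1))) s)) (e₂ s (+ i) j) (e₃ j (+ i)) ⟩
  f (s - + suc i - (j + + 1)) + (σ̃ (j - + suc (suc i)) f s + σ i (λ u → f (u - (j - + 1 + + 1))) s)
    ≡⟨ cong (λ a → f (s - + suc i - (j + + 1)) + (σ̃ (j - + suc (suc i)) f s + a))
         (trans (σ-cong i (λ u → cong f (e₄ u j)) s) (σ-shift i (+ 1) (λ u → f (u - (j + + 1))) s)) ⟩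
  f (s - + suc i - (j + + 1)) + (σ̃ (j - + suc (suc i)) f s + σ i (λ u → f (u - (j + + 1))) (s + + 1))
    ≡⟨ x∙yz≈y∙xz (f (s - + suc i - (j + + 1))) (σ̃ (j - + suc (suc i)) f s) _ ⟩
  σ̃ (j - + suc (suc i)) f s + (f (s - + suc i - (j + + 1)) + σ i (λ u → f (u - (j + + 1))) (s + + 1)) ∎
  where
  open ≡-Reasoning
  e₁ : ∀ s i → s - (+ 1 + (+ 1 + i)) + + 1 ≡ s - (+ 1 + i)
  e₁ = solve-∀
  e₂ : ∀ s i j → s - (+ 1 + (+ 1 + i)) - j ≡ s - (+ 1 + i) - (j + + 1)
  e₂ = solve-∀
  e₃ : ∀ j i → j - + 1 - (+ 1 + i) ≡ j - (+ 1 + (+ 1 + i))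
  e₃ = solve-∀
  e₄ : ∀ u j → u - (j - + 1 + + 1) ≡ u + + 1 - (j + + 1)
  e₄ = solve-∀

σ̃-sum : ℕ → (ℕ → ℤ) → Fun → Fun
σ̃-sum zero    φ f s = + 0
σ̃-sum (suc n) φ f s = σ̃ (φ 0) f s + σ̃-sum n (φ ∘ suc) f s

σ̃-sum-last : ∀ n φ (f : Fun) s → σ̃-sum (suc n) φ f s ≡ σ̃-sum n φ f s + σ̃ (φ n) f s
σ̃-sum-last zero    φ f s = trans (ℤₚ.+-identityʳ (σ̃ (φ 0) f s)) (sym (ℤₚ.+-identityˡ (σ̃ (φ 0) f s)))
σ̃-sum-last (suc n) φ f s = trans (cong (_+_ (σ̃ (φ 0) f s)) (σ̃-sum-last n (φ ∘ suc) f s))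
                                 (sym (ℤₚ.+-assoc (σ̃ (φ 0) f s) _ _))

-- h_i h̃_j = Σₖ₌₀ⁱ h̃_{j-i+2k}, read on test functions.
clebsch-gordan : ∀ i j φ → (∀ k → φ k ≡ (j - + i) + + 2 * + k) →
                 ∀ (f : Fun) s → σ̃-sum (suc i) φ f s ≡ σ i (σ̃ j f) s
clebsch-gordan zero j φ φ≡ f s =
  trans (ℤₚ.+-identityʳ _) (cong (λ k → σ̃ k f s) (trans (φ≡ 0) (e j)))
  where
  e : ∀ j → j - + 0 + + 2 * + 0 ≡ j
  e = solve-∀
clebsch-gordan (suc i) j φ φ≡ f s = begin
  σ̃ (φ 0) f s + σ̃-sum (suc i) (φ ∘ suc) f s
    ≡⟨ cong₂ _+_ (cong (λ k → σ̃ k f s) (trans (φ≡ 0) (e₀ j (+ i))))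
         (clebsch-gordan i (j + + 1) (φ ∘ suc) (λ k → trans (φ≡ (suc k)) (e₁ j (+ i) (+ k))) f s) ⟩
  σ̃ (j - + suc i) f s + σ i (σ̃ (j + + 1) f) s
    ≡⟨ cong (_+_ (σ̃ (j - + suc i) f s)) (σ-cong i unfold s) ⟩
  σ̃ (j - + suc i) f s + σ i (λ u → f (u - (j + + 1)) + σ̃ j f (u + + 1)) s
    ≡⟨ cong (_+_ (σ̃ (j - + suc i) f s))
         (trans (σ-+ i _ _ s) (cong (_+_ (σ i (λ u → f (u - (j + + 1))) s)) (σ-shift i (+ 1) (σ̃ j f) s))) ⟩
  σ̃ (j - + suc i) f s + (σ i (λ u → f (u - (j + + 1))) s + σ i (σ̃ j f) (s + + 1))
    ≡⟨ ℤₚ.+-assoc (σ̃ (j - + suc i) f s) _ _ ⟨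
  σ̃ (j - + suc i) f s + σ i (λ u → f (u - (j + + 1))) s + σ i (σ̃ j f) (s + + 1)
    ≡⟨ cong (λ a → a + σ i (σ̃ j f) (s + + 1)) (σ̃-unfold⁺ i j f s) ⟨
  σ̃ j f (s - + suc i) + σ i (σ̃ j f) (s + + 1) ∎
  where
  open ≡-Reasoning
  e₀ : ∀ j i → j - (+ 1 + i) + + 2 * + 0 ≡ j - (+ 1 + i)
  e₀ = solve-∀
  e₁ : ∀ j i k → j - (+ 1 + i) + + 2 * (+ 1 + k) ≡ j + + 1 - i + + 2 * k
  e₁ = solve-∀
  e₂ : ∀ j → j + + 1 - + 1 ≡ j
  e₂ = solve-∀
  unfold : ∀ u → σ̃ (j + + 1) f u ≡ f (u - (j + + 1)) + σ̃ j f (u + + 1)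
  unfold u = trans (σ̃-unfold (j + + 1) f u) (cong (λ k → f (u - (j + + 1)) + σ̃ k f (u + + 1)) (e₂ j))

σ-suc∘σ-suc : ∀ i j (f : Fun) s →
              σ (suc i) (σ (suc j) f) s ≡ σ i (σ j f) s + σ (suc (suc (i ℕ.+ j))) f s
σ-suc∘σ-suc i j f s = begin
  σ (suc i) (σ (suc j) f) s
    ≡⟨ clebsch-gordan (suc i) (+ suc j) φ (λ k → refl) f s ⟨
  σ̃-sum (suc (suc i)) φ f s
    ≡⟨ σ̃-sum-last (suc i) φ f s ⟩
  σ̃-sum (suc i) φ f s + σ̃ (φ (suc i)) f s
    ≡⟨ cong₂ _+_ (clebsch-gordan i (+ j) φ (λ k → e₁ (+ i) (+ j) (+ k)) f s)
                 (cong (λ k → σ̃ k f s) (trans (e₂ (+ i) (+ j)) (cong (_+_ (+ 2)) (sym (ℤₚ.pos-+ i j))))) ⟩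
  σ i (σ j f) s + σ (suc (suc (i ℕ.+ j))) f s ∎
  where
  open ≡-Reasoning
  φ : ℕ → ℤ
  φ k = (+ suc j - + suc i) + + 2 * + k
  e₁ : ∀ i j k → (+ 1 + j - (+ 1 + i)) + + 2 * k ≡ (j - i) + + 2 * k
  e₁ = solve-∀
  e₂ : ∀ i j → (+ 1 + j - (+ 1 + i)) + + 2 * (+ 1 + i) ≡ + 2 + (i + j)
  e₂ = solve-∀

-- Actions of CH₂ and CH̃₂ on functions

⟪_⟫ : CH₂ → Fun → Fun
⟪ [] ⟫          f s = + 0
⟪ (i , a) ∷ x ⟫ f s = a * σ i f s + ⟪ x ⟫ f s

⟦_⟧ : CH̃₂ → Fun → Fun
⟦ [] ⟧          f s = + 0
⟦ (j , c) ∷ g ⟧ f s = c * σ̃ j f s + ⟦ g ⟧ f s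

⟪++⟫ : ∀ x y (f : Fun) s → ⟪ x ++ y ⟫ f s ≡ ⟪ x ⟫ f s + ⟪ y ⟫ f s
⟪++⟫ []            y f s = sym (ℤₚ.+-identityˡ _)
⟪++⟫ ((i , a) ∷ x) y f s =
  trans (cong (_+_ (a * σ i f s)) (⟪++⟫ x y f s)) (sym (ℤₚ.+-assoc (a * σ i f s) _ _))

⟦++⟧ : ∀ g g′ (f : Fun) s → ⟦ g ++ g′ ⟧ f s ≡ ⟦ g ⟧ f s + ⟦ g′ ⟧ f s
⟦++⟧ []            g′ f s = sym (ℤₚ.+-identityˡ _)
⟦++⟧ ((j , c) ∷ g) g′ f s =
  trans (cong (_+_ (c * σ̃ j f s)) (⟦++⟧ g g′ f s)) (sym (ℤₚ.+-assoc (c * σ̃ j f s) _ _))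

⟪L⟫ : ∀ g (f : Fun) s → ⟪ L g ⟫ f s ≡ ⟦ g ⟧ f s
⟪L⟫ []                          f s = refl
⟪L⟫ ((+ n , c) ∷ g) f s =
  trans (⟪++⟫ ((n , c) ∷ []) (L g) f s) (cong₂ _+_ (ℤₚ.+-identityʳ (c * σ n f s)) (⟪L⟫ g f s))
⟪L⟫ ((-[1+ zero ] , c) ∷ g) f s =
  trans (⟪L⟫ g f s) (sym (trans (cong (_+ ⟦ g ⟧ f s) (ℤₚ.*-zeroʳ c)) (ℤₚ.+-identityˡ _)))
⟪L⟫ ((-[1+ suc m ] , c) ∷ g) f s =
  trans (⟪++⟫ ((m , - c) ∷ []) (L g) f s)
        (cong₂ _+_ (trans (ℤₚ.+-identityʳ _) (e c (σ m f s))) (⟪L⟫ g f s))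
  where
  e : ∀ c x → - c * x ≡ c * - x
  e = solve-∀

⟦scale⟧ : ∀ c g (f : Fun) s → ⟦ scale c g ⟧ f s ≡ c * ⟦ g ⟧ f s
⟦scale⟧ c []            f s = sym (ℤₚ.*-zeroʳ c)
⟦scale⟧ c ((j , b) ∷ g) f s =
  trans (cong (_+_ (c * b * σ̃ j f s)) (⟦scale⟧ c g f s)) (e c b (σ̃ j f s) (⟦ g ⟧ f s))
  where
  e : ∀ c b x y → c * b * x + c * y ≡ c * (b * x + y)
  e = solve-∀

⟦map-applyUpTo⟧ : ∀ (φ : ℕ → ℤ) θ n (f : Fun) s →
                  ⟦ map (λ k → (φ k , + 1)) (applyUpTo θ n) ⟧ f s ≡ σ̃-sum n (φ ∘ θ) f s
⟦map-applyUpTo⟧ φ θ zero    f s = refl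
⟦map-applyUpTo⟧ φ θ (suc n) f s =
  cong₂ _+_ (ℤₚ.*-identityˡ (σ̃ (φ (θ 0)) f s)) (⟦map-applyUpTo⟧ φ (θ ∘ suc) n f s)

⟦actBasis⟧ : ∀ i j (f : Fun) s → ⟦ actBasis i j ⟧ f s ≡ σ i (σ̃ j f) s
⟦actBasis⟧ i j f s = trans (⟦map-applyUpTo⟧ φ (λ k → k) (suc i) f s) (clebsch-gordan i j φ (λ k → refl) f s)
  where
  φ : ℕ → ℤ
  φ k = (j - + i) + + 2 * + k

⟦⟧-cong : ∀ g {f f′ : Fun} → (∀ u → f u ≡ f′ u) → ∀ s → ⟦ g ⟧ f s ≡ ⟦ g ⟧ f′ s
⟦⟧-cong []            f≗f′ s = refl
⟦⟧-cong ((j , c) ∷ g) f≗f′ s = cong₂ _+_ (cong (c *_) (σ̃-cong j f≗f′ s)) (⟦⟧-cong g f≗f′ s)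

⟦⟧-+ : ∀ g (f f′ : Fun) s → ⟦ g ⟧ (λ u → f u + f′ u) s ≡ ⟦ g ⟧ f s + ⟦ g ⟧ f′ s
⟦⟧-+ []            f f′ s = refl
⟦⟧-+ ((j , c) ∷ g) f f′ s rewrite σ̃-+ j f f′ s | ⟦⟧-+ g f f′ s =
  e c (σ̃ j f s) (σ̃ j f′ s) (⟦ g ⟧ f s) (⟦ g ⟧ f′ s)
  where
  e : ∀ c a b x y → c * (a + b) + (x + y) ≡ c * a + x + (c * b + y)
  e = solve-∀

⟦⟧-scale : ∀ g c (f : Fun) s → ⟦ g ⟧ (λ u → c * f u) s ≡ c * ⟦ g ⟧ f s
⟦⟧-scale []            c f s = sym (ℤₚ.*-zeroʳ c)
⟦⟧-scale ((j , b) ∷ g) c f s rewrite σ̃-scale j c f s | ⟦⟧-scale g c f s =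
  e c b (σ̃ j f s) (⟦ g ⟧ f s)
  where
  e : ∀ c b x y → b * (c * x) + c * y ≡ c * (b * x + y)
  e = solve-∀

⟦⟧-zero : ∀ g s → ⟦ g ⟧ (λ _ → + 0) s ≡ + 0
⟦⟧-zero []            s = refl
⟦⟧-zero ((j , c) ∷ g) s rewrite σ̃-zero j s | ⟦⟧-zero g s = cong (_+ + 0) (ℤₚ.*-zeroʳ c)

-- The pattern lambdas inside Defs.act cannot be named here, so they enter through their equations.
⟦act⟧ : ∀ x g (f : Fun) s → ⟦ act x g ⟧ f s ≡ ⟪ x ⟫ (⟦ g ⟧ f) s
⟦act⟧ x g f s = ⟦x·g⟧ _ (λ i a → ⟦a·hᵢ·g⟧ i a _ (λ j b → refl) g) x f s
  where
  ⟦a·hᵢ·g⟧ : ∀ i a (F : ℤ × ℤ → CH̃₂) → (∀ j b → F (j , b) ≡ scale (a * b) (actBasis i j)) →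
          ∀ g (f : Fun) s → ⟦ concatMap F g ⟧ f s ≡ a * σ i (⟦ g ⟧ f) s
  ⟦a·hᵢ·g⟧ i a F F≡ [] f s = sym (trans (cong (a *_) (σ-zero i s)) (ℤₚ.*-zeroʳ a))
  ⟦a·hᵢ·g⟧ i a F F≡ ((j , b) ∷ g) f s = begin
    ⟦ F (j , b) ++ concatMap F g ⟧ f s
      ≡⟨ ⟦++⟧ (F (j , b)) (concatMap F g) f s ⟩
    ⟦ F (j , b) ⟧ f s + ⟦ concatMap F g ⟧ f s
      ≡⟨ cong₂ _+_ (trans (cong (λ t → ⟦ t ⟧ f s) (F≡ j b))
                          (trans (⟦scale⟧ (a * b) (actBasis i j) f s) (cong ((a * b) *_) (⟦actBasis⟧ i j f s))))
                   (⟦a·hᵢ·g⟧ i a F F≡ g f s) ⟩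
    a * b * σ i (σ̃ j f) s + a * σ i (⟦ g ⟧ f) s
      ≡⟨ e a b (σ i (σ̃ j f) s) (σ i (⟦ g ⟧ f) s) ⟩
    a * (b * σ i (σ̃ j f) s + σ i (⟦ g ⟧ f) s)
      ≡⟨ cong (a *_) (trans (σ-+ i (λ u → b * σ̃ j f u) (⟦ g ⟧ f) s)
                            (cong (_+ σ i (⟦ g ⟧ f) s) (σ-scale i b (σ̃ j f) s))) ⟨
    a * σ i (⟦ (j , b) ∷ g ⟧ f) s ∎
    where
    open ≡-Reasoning
    e : ∀ a b x y → a * b * x + a * y ≡ a * (b * x + y)
    e = solve-∀
  ⟦x·g⟧ : ∀ (F : ℕ × ℤ → CH̃₂) → (∀ i a (f : Fun) s → ⟦ F (i , a) ⟧ f s ≡ a * σ i (⟦ g ⟧ f) s) →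
          ∀ x (f : Fun) s → ⟦ concatMap F x ⟧ f s ≡ ⟪ x ⟫ (⟦ g ⟧ f) s
  ⟦x·g⟧ F F≡ []            f s = refl
  ⟦x·g⟧ F F≡ ((i , a) ∷ x) f s =
    trans (⟦++⟧ (F (i , a)) (concatMap F x) f s) (cong₂ _+_ (F≡ i a f s) (⟦x·g⟧ F F≡ x f s))

⟦·⟧ : ∀ g₁ g₂ (f : Fun) s → ⟦ g₁ · g₂ ⟧ f s ≡ ⟦ g₁ ⟧ (⟦ g₂ ⟧ f) s
⟦·⟧ g₁ g₂ f s = trans (⟦act⟧ (L g₁) g₂ f s) (⟪L⟫ g₁ (⟦ g₂ ⟧ f) s)

σ̃-⟦⟧-comm : ∀ j g (f : Fun) s → σ̃ j (⟦ g ⟧ f) s ≡ ⟦ g ⟧ (σ̃ j f) s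
σ̃-⟦⟧-comm j []             f s = σ̃-zero j s
σ̃-⟦⟧-comm j ((j′ , c) ∷ g) f s = begin
  σ̃ j (λ u → c * σ̃ j′ f u + ⟦ g ⟧ f u) s
    ≡⟨ σ̃-+ j (λ u → c * σ̃ j′ f u) (⟦ g ⟧ f) s ⟩
  σ̃ j (λ u → c * σ̃ j′ f u) s + σ̃ j (⟦ g ⟧ f) s
    ≡⟨ cong₂ _+_ (trans (σ̃-scale j c (σ̃ j′ f) s) (cong (c *_) (σ̃-comm j j′ f s))) (σ̃-⟦⟧-comm j g f s) ⟩
  c * σ̃ j′ (σ̃ j f) s + ⟦ g ⟧ (σ̃ j f) s ∎
  where open ≡-Reasoning

⟦⟧-comm : ∀ g g′ (f : Fun) s → ⟦ g ⟧ (⟦ g′ ⟧ f) s ≡ ⟦ g′ ⟧ (⟦ g ⟧ f) s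
⟦⟧-comm []            g′ f s = sym (⟦⟧-zero g′ s)
⟦⟧-comm ((j , c) ∷ g) g′ f s = begin
  c * σ̃ j (⟦ g′ ⟧ f) s + ⟦ g ⟧ (⟦ g′ ⟧ f) s
    ≡⟨ cong₂ _+_ (cong (c *_) (σ̃-⟦⟧-comm j g′ f s)) (⟦⟧-comm g g′ f s) ⟩
  c * ⟦ g′ ⟧ (σ̃ j f) s + ⟦ g′ ⟧ (⟦ g ⟧ f) s
    ≡⟨ trans (⟦⟧-+ g′ (λ u → c * σ̃ j f u) (⟦ g ⟧ f) s) (cong (_+ ⟦ g′ ⟧ (⟦ g ⟧ f) s) (⟦⟧-scale g′ c (σ̃ j f) s)) ⟨
  ⟦ g′ ⟧ (λ u → c * σ̃ j f u + ⟦ g ⟧ f u) s ∎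
  where open ≡-Reasoning

-- CH̃₂ as a commutative ring

infix 4 _≈_
record _≈_ (g g′ : CH̃₂) : Set where
  constructor mk≈
  field at : ∀ f s → ⟦ g ⟧ f s ≡ ⟦ g′ ⟧ f s
open _≈_

≈-refl : ∀ {g} → g ≈ g
≈-refl = mk≈ λ f s → refl

≈-sym : ∀ {g g′} → g ≈ g′ → g′ ≈ g
≈-sym g≈g′ = mk≈ λ f s → sym (at g≈g′ f s)

≈-trans : ∀ {g g′ g″} → g ≈ g′ → g′ ≈ g″ → g ≈ g″
≈-trans g≈g′ g′≈g″ = mk≈ λ f s → trans (at g≈g′ f s) (at g′≈g″ f s)

≡⇒≈ : ∀ {g g′} → g ≡ g′ → g ≈ g′
≡⇒≈ refl = ≈-refl

neg : CH̃₂ → CH̃₂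
neg = scale (- + 1)

⟦neg⟧ : ∀ g (f : Fun) s → ⟦ neg g ⟧ f s ≡ - ⟦ g ⟧ f s
⟦neg⟧ g f s = trans (⟦scale⟧ (- + 1) g f s) (ℤₚ.-1*i≡-i (⟦ g ⟧ f s))

⊕-cong : ∀ {x x′ y y′} → x ≈ x′ → y ≈ y′ → x ⊕ y ≈ x′ ⊕ y′
⊕-cong {x} {x′} {y} {y′} x≈x′ y≈y′ = mk≈ λ f s →
  trans (⟦++⟧ x y f s) (trans (cong₂ _+_ (at x≈x′ f s) (at y≈y′ f s)) (sym (⟦++⟧ x′ y′ f s)))

⊕-comm : ∀ x y → x ⊕ y ≈ y ⊕ x
⊕-comm x y = mk≈ λ f s →
  trans (⟦++⟧ x y f s) (trans (ℤₚ.+-comm (⟦ x ⟧ f s) _) (sym (⟦++⟧ y x f s)))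

neg-cong : ∀ {x y} → x ≈ y → neg x ≈ neg y
neg-cong {x} {y} x≈y = mk≈ λ f s →
  trans (⟦neg⟧ x f s) (trans (cong -_ (at x≈y f s)) (sym (⟦neg⟧ y f s)))

neg-inverseˡ : ∀ x → neg x ⊕ x ≈ []
neg-inverseˡ x = mk≈ λ f s →
  trans (⟦++⟧ (neg x) x f s) (trans (cong (_+ ⟦ x ⟧ f s) (⟦neg⟧ x f s)) (ℤₚ.+-inverseˡ (⟦ x ⟧ f s)))

neg-inverseʳ : ∀ x → x ⊕ neg x ≈ []
neg-inverseʳ x = ≈-trans (⊕-comm x (neg x)) (neg-inverseˡ x)

·-cong : ∀ {x x′ y y′} → x ≈ x′ → y ≈ y′ → x · y ≈ x′ · y′
·-cong {x} {x′} {y} {y′} x≈x′ y≈y′ = mk≈ λ f s → begin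
  ⟦ x · y ⟧ f s         ≡⟨ ⟦·⟧ x y f s ⟩
  ⟦ x ⟧ (⟦ y ⟧ f) s     ≡⟨ at x≈x′ (⟦ y ⟧ f) s ⟩
  ⟦ x′ ⟧ (⟦ y ⟧ f) s    ≡⟨ ⟦⟧-cong x′ (at y≈y′ f) s ⟩
  ⟦ x′ ⟧ (⟦ y′ ⟧ f) s   ≡⟨ ⟦·⟧ x′ y′ f s ⟨
  ⟦ x′ · y′ ⟧ f s       ∎
  where open ≡-Reasoning

·-assoc : ∀ x y w → (x · y) · w ≈ x · (y · w)
·-assoc x y w = mk≈ λ f s → begin
  ⟦ (x · y) · w ⟧ f s        ≡⟨ ⟦·⟧ (x · y) w f s ⟩
  ⟦ x · y ⟧ (⟦ w ⟧ f) s      ≡⟨ ⟦·⟧ x y (⟦ w ⟧ f) s ⟩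
  ⟦ x ⟧ (⟦ y ⟧ (⟦ w ⟧ f)) s  ≡⟨ ⟦⟧-cong x (⟦·⟧ y w f) s ⟨
  ⟦ x ⟧ (⟦ y · w ⟧ f) s      ≡⟨ ⟦·⟧ x (y · w) f s ⟨
  ⟦ x · (y · w) ⟧ f s        ∎
  where open ≡-Reasoning

⟦h̃0⟧ : ∀ (f : Fun) s → ⟦ h̃ (+ 0) ⟧ f s ≡ f s
⟦h̃0⟧ f s = trans (ℤₚ.+-identityʳ _) (ℤₚ.*-identityˡ (f s))

·-identityˡ : ∀ x → h̃ (+ 0) · x ≈ x
·-identityˡ x = mk≈ λ f s → trans (⟦·⟧ (h̃ (+ 0)) x f s) (⟦h̃0⟧ (⟦ x ⟧ f) s)

·-identityʳ : ∀ x → x · h̃ (+ 0) ≈ x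
·-identityʳ x = mk≈ λ f s → trans (⟦·⟧ x (h̃ (+ 0)) f s) (⟦⟧-cong x (⟦h̃0⟧ f) s)

·-zeroʳ : ∀ x → x · [] ≈ []
·-zeroʳ x = mk≈ λ f s → trans (⟦·⟧ x [] f s) (⟦⟧-zero x s)

·-distribˡ : ∀ x y w → x · (y ⊕ w) ≈ x · y ⊕ x · w
·-distribˡ x y w = mk≈ λ f s → begin
  ⟦ x · (y ⊕ w) ⟧ f s                    ≡⟨ ⟦·⟧ x (y ⊕ w) f s ⟩
  ⟦ x ⟧ (⟦ y ⊕ w ⟧ f) s                  ≡⟨ ⟦⟧-cong x (⟦++⟧ y w f) s ⟩
  ⟦ x ⟧ (λ u → ⟦ y ⟧ f u + ⟦ w ⟧ f u) s  ≡⟨ ⟦⟧-+ x (⟦ y ⟧ f) (⟦ w ⟧ f) s ⟩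
  ⟦ x ⟧ (⟦ y ⟧ f) s + ⟦ x ⟧ (⟦ w ⟧ f) s  ≡⟨ cong₂ _+_ (⟦·⟧ x y f s) (⟦·⟧ x w f s) ⟨
  ⟦ x · y ⟧ f s + ⟦ x · w ⟧ f s          ≡⟨ ⟦++⟧ (x · y) (x · w) f s ⟨
  ⟦ x · y ⊕ x · w ⟧ f s                  ∎
  where open ≡-Reasoning

·-distribʳ : ∀ x y w → (y ⊕ w) · x ≈ y · x ⊕ w · x
·-distribʳ x y w = mk≈ λ f s → begin
  ⟦ (y ⊕ w) · x ⟧ f s                    ≡⟨ ⟦·⟧ (y ⊕ w) x f s ⟩
  ⟦ y ⊕ w ⟧ (⟦ x ⟧ f) s                  ≡⟨ ⟦++⟧ y w (⟦ x ⟧ f) s ⟩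
  ⟦ y ⟧ (⟦ x ⟧ f) s + ⟦ w ⟧ (⟦ x ⟧ f) s  ≡⟨ cong₂ _+_ (⟦·⟧ y x f s) (⟦·⟧ w x f s) ⟨
  ⟦ y · x ⟧ f s + ⟦ w · x ⟧ f s          ≡⟨ ⟦++⟧ (y · x) (w · x) f s ⟨
  ⟦ y · x ⊕ w · x ⟧ f s                  ∎
  where open ≡-Reasoning

·-comm : ∀ x y → x · y ≈ y · x
·-comm x y = mk≈ λ f s →
  trans (⟦·⟧ x y f s) (trans (⟦⟧-comm x y f s) (sym (⟦·⟧ y x f s)))

CH̃₂-commutativeRing : CommutativeRing _ _
CH̃₂-commutativeRing = record
  { Carrier = CH̃₂ ; _≈_ = _≈_ ; _+_ = _⊕_ ; _*_ = _·_ ; -_ = neg ; 0# = [] ; 1# = h̃ (+ 0)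
  ; isCommutativeRing = record
    { isRing = record
      { +-isAbelianGroup = record
        { isGroup = record
          { isMonoid = record
            { isSemigroup = record
              { isMagma = record
                { isEquivalence = record { refl = ≈-refl ; sym = ≈-sym ; trans = ≈-trans }
                ; ∙-cong = ⊕-cong
                }
              ; assoc = λ x y w → ≡⇒≈ (Listₚ.++-assoc x y w)
              }
            ; identity = (λ x → ≈-refl) , (λ x → ≡⇒≈ (Listₚ.++-identityʳ x))
            }
          ; inverse = neg-inverseˡ , neg-inverseʳ
          ; ⁻¹-cong = neg-cong
          }
        ; comm = ⊕-comm
        }
      ; *-cong = ·-cong
      ; *-assoc = ·-assoc
      ; *-identity = ·-identityˡ , ·-identityʳ
      ; distrib = ·-distribˡ , ·-distribʳ
      }
    ; *-comm = ·-comm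
    }
  }

module ≈-Reasoning = Relation.Binary.Reasoning.Setoid (CommutativeRing.setoid CH̃₂-commutativeRing)


-- Factorisation of ẽ

⊖-cong : ∀ {x x′ y y′} → x ≈ x′ → y ≈ y′ → x ⊖ y ≈ x′ ⊖ y′
⊖-cong x≈x′ y≈y′ = ⊕-cong x≈x′ (neg-cong y≈y′)

⊕-⊖-cancelˡ : ∀ x y → x ⊕ y ⊖ x ≈ y
⊕-⊖-cancelˡ x y = mk≈ λ f s → begin
  ⟦ x ⊕ y ⊖ x ⟧ f s                         ≡⟨ ⟦++⟧ (x ⊕ y) (neg x) f s ⟩
  ⟦ x ⊕ y ⟧ f s + ⟦ neg x ⟧ f s             ≡⟨ cong₂ _+_ (⟦++⟧ x y f s) (⟦neg⟧ x f s) ⟩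
  ⟦ x ⟧ f s + ⟦ y ⟧ f s + - ⟦ x ⟧ f s       ≡⟨ e (⟦ x ⟧ f s) (⟦ y ⟧ f s) ⟩
  ⟦ y ⟧ f s                                 ∎
  where
  open ≡-Reasoning
  e : ∀ a b → a + b + - a ≡ b
  e = solve-∀

⊕-⊖-⊕ : ∀ x y → x ⊕ x ⊖ (x ⊕ y) ≈ x ⊖ y
⊕-⊖-⊕ x y = mk≈ λ f s → begin
  ⟦ x ⊕ x ⊖ (x ⊕ y) ⟧ f s                             ≡⟨ ⟦++⟧ (x ⊕ x) (neg (x ⊕ y)) f s ⟩
  ⟦ x ⊕ x ⟧ f s + ⟦ neg (x ⊕ y) ⟧ f s                 ≡⟨ cong₂ _+_ (⟦++⟧ x x f s) (⟦neg⟧ (x ⊕ y) f s) ⟩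
  ⟦ x ⟧ f s + ⟦ x ⟧ f s + - ⟦ x ⊕ y ⟧ f s             ≡⟨ cong (λ t → ⟦ x ⟧ f s + ⟦ x ⟧ f s + - t) (⟦++⟧ x y f s) ⟩
  ⟦ x ⟧ f s + ⟦ x ⟧ f s + - (⟦ x ⟧ f s + ⟦ y ⟧ f s)   ≡⟨ e (⟦ x ⟧ f s) (⟦ y ⟧ f s) ⟩
  ⟦ x ⟧ f s + - ⟦ y ⟧ f s                             ≡⟨ cong (_+_ (⟦ x ⟧ f s)) (⟦neg⟧ y f s) ⟨
  ⟦ x ⟧ f s + ⟦ neg y ⟧ f s                           ≡⟨ ⟦++⟧ x (neg y) f s ⟨
  ⟦ x ⊖ y ⟧ f s                                       ∎
  where
  open ≡-Reasoning
  e : ∀ a b → a + a + - (a + b) ≡ a + - b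
  e = solve-∀

⊕-·⊖-annihilate : ∀ x y → x ⊕ y · y · (y ⊖ y) ≈ x
⊕-·⊖-annihilate x y = begin
  x ⊕ y · y · (y ⊖ y)  ≈⟨ ⊕-cong (≈-refl {x}) (·-cong (≈-refl {y}) (·-cong (≈-refl {y}) (neg-inverseʳ y))) ⟩
  x ⊕ y · y · []       ≈⟨ ⊕-cong (≈-refl {x}) (≈-trans (·-cong (≈-refl {y}) (·-zeroʳ y)) (·-zeroʳ y)) ⟩
  x ⊕ []               ≈⟨ ≡⇒≈ (Listₚ.++-identityʳ x) ⟩
  x                    ∎
  where open ≈-Reasoning

h : ℕ → CH̃₂
h m = h̃ (+ m)

⟦h⟧ : ∀ m (f : Fun) s → ⟦ h m ⟧ f s ≡ σ m f s
⟦h⟧ m f s = trans (ℤₚ.+-identityʳ _) (ℤₚ.*-identityˡ (σ m f s))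

⟦h·h⟧ : ∀ a b (f : Fun) s → ⟦ h a · h b ⟧ f s ≡ σ a (σ b f) s
⟦h·h⟧ a b f s = trans (⟦·⟧ (h a) (h b) f s) (trans (⟦h⟧ a (⟦ h b ⟧ f) s) (σ-cong a (⟦h⟧ b f) s))

h-suc·h-suc : ∀ i j → h (suc i) · h (suc j) ≈ h i · h j ⊕ h (suc (suc (i ℕ.+ j)))
h-suc·h-suc i j = mk≈ λ f s → begin
  ⟦ h (suc i) · h (suc j) ⟧ f s                          ≡⟨ ⟦h·h⟧ (suc i) (suc j) f s ⟩
  σ (suc i) (σ (suc j) f) s                              ≡⟨ σ-suc∘σ-suc i j f s ⟩
  σ i (σ j f) s + σ (suc (suc (i ℕ.+ j))) f s            ≡⟨ cong₂ _+_ (⟦h·h⟧ i j f s) (⟦h⟧ (suc (suc (i ℕ.+ j))) f s) ⟨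
  ⟦ h i · h j ⟧ f s + ⟦ h (suc (suc (i ℕ.+ j))) ⟧ f s    ≡⟨ ⟦++⟧ (h i · h j) (h (suc (suc (i ℕ.+ j)))) f s ⟨
  ⟦ h i · h j ⊕ h (suc (suc (i ℕ.+ j))) ⟧ f s            ∎
  where open ≡-Reasoning

h1·h-suc : ∀ r → h 1 · h (suc r) ≈ h (suc (suc r)) ⊕ h r
h1·h-suc r = begin
  h 1 · h (suc r)             ≈⟨ h-suc·h-suc 0 r ⟩
  h 0 · h r ⊕ h (suc (suc r)) ≈⟨ ⊕-cong (·-identityˡ (h r)) (≈-refl {h (suc (suc r))}) ⟩
  h r ⊕ h (suc (suc r))       ≈⟨ ⊕-comm (h r) (h (suc (suc r))) ⟩
  h (suc (suc r)) ⊕ h r       ∎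
  where open ≈-Reasoning

h-cong : ∀ {m m′} → m ≡ m′ → h m ≈ h m′
h-cong refl = ≈-refl

h-square-difference : ∀ r → h (suc (suc r)) · h (suc (suc r)) ⊖ h (suc r) · h (suc r) ≈ h (4 ℕ.+ (r ℕ.+ r))
h-square-difference r = begin
  h (2 ℕ.+ r) · h (2 ℕ.+ r) ⊖ h (suc r) · h (suc r)
    ≈⟨ ⊖-cong (h-suc·h-suc (suc r) (suc r)) (≈-refl {h (suc r) · h (suc r)}) ⟩
  h (suc r) · h (suc r) ⊕ h (2 ℕ.+ (suc r ℕ.+ suc r)) ⊖ h (suc r) · h (suc r)
    ≈⟨ ⊕-⊖-cancelˡ (h (suc r) · h (suc r)) _ ⟩
  h (2 ℕ.+ (suc r ℕ.+ suc r))
    ≈⟨ h-cong (cong (λ k → 3 ℕ.+ k) (ℕₚ.+-suc r r)) ⟩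
  h (4 ℕ.+ (r ℕ.+ r)) ∎
  where open ≈-Reasoning

h-mixed-difference : ∀ r → let a = h (suc (suc r)); b = h (suc r) in
                     b · a ⊕ a · b ⊖ b · h 1 · b ≈ h (3 ℕ.+ (r ℕ.+ r))
h-mixed-difference r = begin
  b · a ⊕ a · b ⊖ b · h 1 · b
    ≈⟨ ⊖-cong (⊕-cong (≈-refl {b · a}) (·-comm a b))
              (≈-trans (·-cong (≈-refl {b}) (h1·h-suc r))
                       (≈-trans (·-distribˡ b a c) (⊕-cong (≈-refl {b · a}) (·-comm b c)))) ⟩
  b · a ⊕ b · a ⊖ (b · a ⊕ c · b)
    ≈⟨ ⊕-⊖-⊕ (b · a) (c · b) ⟩
  b · a ⊖ c · b
    ≈⟨ ⊖-cong (h-suc·h-suc r (suc r)) (≈-refl {c · b}) ⟩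
  c · b ⊕ h (2 ℕ.+ (r ℕ.+ suc r)) ⊖ c · b
    ≈⟨ ⊕-⊖-cancelˡ (c · b) _ ⟩
  h (2 ℕ.+ (r ℕ.+ suc r))
    ≈⟨ h-cong (cong (2 ℕ.+_) (ℕₚ.+-suc r r)) ⟩
  h (3 ℕ.+ (r ℕ.+ r)) ∎
  where
  open ≈-Reasoning
  a b c : CH̃₂
  a = h (suc (suc r))
  b = h (suc r)
  c = h r

CH̃₂-almostCommutativeRing : AlmostCommutativeRing _ _
CH̃₂-almostCommutativeRing = fromCommutativeRing CH̃₂-commutativeRing (λ _ → nothing)

step₀-factorisation : ∀ g a b → (g · a) · ((g · a) · (g · a) ⊖ (g · b) · (g · b)) ≈ (g · g · g · a) · (a · a ⊖ b · b)
step₀-factorisation = ring-solve CH̃₂-almostCommutativeRing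

step₁-factorisation : ∀ g a b c → (g · b) · (g · a) · (g · a) ⊕ (g · a) · (g · a) · (g · b) ⊖ (g · b) · c · (g · a) · (g · b)
                      ≈ (g · g · g · a) · (b · a ⊕ a · b ⊖ b · c · b)
step₁-factorisation = ring-solve CH̃₂-almostCommutativeRing

-- ρ n = 2ⁿ⁺¹ − 2
ρ : ℕ → ℕ
ρ zero    = 0
ρ (suc n) = 2 ℕ.+ (ρ n ℕ.+ ρ n)

G : ℕ → CH̃₂
G zero    = h 0
G (suc n) = G n · G n · G n · h (2 ℕ.+ ρ n)

Factorised : ℕ → Set
Factorised n = ẽ n z ≈ G n · h (2 ℕ.+ ρ n) × ẽ n p1 ≈ G n · h (1 ℕ.+ ρ n) × ẽ n m1 ≈ G n · h (1 ℕ.+ ρ n)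

factorised : ∀ n → Factorised n
factorised zero = ≈-sym (·-identityˡ (h 2)) , ≈-sym (·-identityˡ (h 1)) , ≈-sym (·-identityˡ (h 1))
factorised (suc n) with factorised n
... | e0≈ , e1≈ , em1≈ = e0′≈ , e1′≈ , em1′≈
  where
  open ≈-Reasoning
  a b e0 e1 em1 e1′ : CH̃₂
  a = h (2 ℕ.+ ρ n)
  b = h (1 ℕ.+ ρ n)
  e0 = ẽ n z
  e1 = ẽ n p1
  em1 = ẽ n m1
  e1′ = e1 · e0 · e0 ⊕ e0 · e0 · e1 ⊖ e1 · h 1 · e0 · e1

  e0′≈ : e0 · (e0 · e0 ⊖ e1 · e1) ≈ G (suc n) · h (2 ℕ.+ ρ (suc n))
  e0′≈ = begin
    e0 · (e0 · e0 ⊖ e1 · e1)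
      ≈⟨ ·-cong e0≈ (⊖-cong (·-cong e0≈ e0≈) (·-cong e1≈ e1≈)) ⟩
    (G n · a) · ((G n · a) · (G n · a) ⊖ (G n · b) · (G n · b))
      ≈⟨ step₀-factorisation (G n) a b ⟩
    G (suc n) · (a · a ⊖ b · b)
      ≈⟨ ·-cong (≈-refl {G (suc n)}) (h-square-difference (ρ n)) ⟩
    G (suc n) · h (2 ℕ.+ ρ (suc n)) ∎

  e1′≈ : e1′ ≈ G (suc n) · h (1 ℕ.+ ρ (suc n))
  e1′≈ = begin
    e1 · e0 · e0 ⊕ e0 · e0 · e1 ⊖ e1 · h 1 · e0 · e1
      ≈⟨ ⊖-cong (⊕-cong (·-cong e1≈ (·-cong e0≈ e0≈)) (·-cong e0≈ (·-cong e0≈ e1≈)))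
                (·-cong e1≈ (·-cong (≈-refl {h 1}) (·-cong e0≈ e1≈))) ⟩
    (G n · b) · (G n · a) · (G n · a) ⊕ (G n · a) · (G n · a) · (G n · b) ⊖ (G n · b) · h 1 · (G n · a) · (G n · b)
      ≈⟨ step₁-factorisation (G n) a b (h 1) ⟩
    G (suc n) · (b · a ⊕ a · b ⊖ b · h 1 · b)
      ≈⟨ ·-cong (≈-refl {G (suc n)}) (h-mixed-difference (ρ n)) ⟩
    G (suc n) · h (1 ℕ.+ ρ (suc n)) ∎

  em1′≈ : e1′ ⊕ em1 · em1 · (em1 ⊖ e1) ≈ G (suc n) · h (1 ℕ.+ ρ (suc n))
  em1′≈ = begin
    e1′ ⊕ em1 · em1 · (em1 ⊖ e1)
      ≈⟨ ⊕-cong (≈-refl {e1′}) (·-cong em1≈ (·-cong em1≈ (⊖-cong em1≈ e1≈))) ⟩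
    e1′ ⊕ (G n · b) · (G n · b) · (G n · b ⊖ G n · b)
      ≈⟨ ⊕-·⊖-annihilate e1′ (G n · b) ⟩
    e1′
      ≈⟨ e1′≈ ⟩
    G (suc n) · h (1 ℕ.+ ρ (suc n)) ∎

-- Positivity

sumH : List ℕ → CH̃₂
sumH = map (λ m → (+ m , + 1))

InCH̃₂⁺ : CH̃₂ → Set
InCH̃₂⁺ g = ∃[ ms ] g ≈ sumH ms

InCH̃₂⁺-resp-≈ : ∀ {x y} → x ≈ y → InCH̃₂⁺ y → InCH̃₂⁺ x
InCH̃₂⁺-resp-≈ x≈y (ms , y≈ms) = ms , ≈-trans x≈y y≈ms

InCH̃₂⁺-⊕ : ∀ {x y} → InCH̃₂⁺ x → InCH̃₂⁺ y → InCH̃₂⁺ (x ⊕ y)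
InCH̃₂⁺-⊕ (ms , x≈ms) (ms′ , y≈ms′) =
  ms ++ ms′ , ≈-trans (⊕-cong x≈ms y≈ms′) (≡⇒≈ (sym (Listₚ.map-++ _ ms ms′)))

InCH̃₂⁺-h : ∀ m → InCH̃₂⁺ (h m)
InCH̃₂⁺-h m = m ∷ [] , ≈-refl

h·h-clebsch-gordan : ∀ a d → h a · h (a ℕ.+ d) ≈ sumH (applyUpTo (λ k → d ℕ.+ 2 ℕ.* k) (suc a))
h·h-clebsch-gordan a d = mk≈ λ f s → begin
  ⟦ h a · h (a ℕ.+ d) ⟧ f s
    ≡⟨ ⟦h·h⟧ a (a ℕ.+ d) f s ⟩
  σ a (σ̃ (+ (a ℕ.+ d)) f) s
    ≡⟨ clebsch-gordan a (+ (a ℕ.+ d)) (+_ ∘ ψ) index≡ f s ⟨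
  σ̃-sum (suc a) (+_ ∘ ψ) f s
    ≡⟨ ⟦map-applyUpTo⟧ +_ ψ (suc a) f s ⟨
  ⟦ sumH (applyUpTo ψ (suc a)) ⟧ f s ∎
  where
  open ≡-Reasoning
  ψ : ℕ → ℕ
  ψ k = d ℕ.+ 2 ℕ.* k
  e : ∀ a d k → d + + 2 * k ≡ (a + d - a) + + 2 * k
  e = solve-∀
  index≡ : ∀ k → + ψ k ≡ (+ (a ℕ.+ d) - + a) + + 2 * + k
  index≡ k = begin
    + (d ℕ.+ 2 ℕ.* k)            ≡⟨ ℤₚ.pos-+ d (2 ℕ.* k) ⟩
    + d + + (2 ℕ.* k)            ≡⟨ cong (_+_ (+ d)) (ℤₚ.pos-* 2 k) ⟩
    + d + + 2 * + k              ≡⟨ e (+ a) (+ d) (+ k) ⟩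
    (+ a + + d - + a) + + 2 * + k ≡⟨ cong (λ t → (t - + a) + + 2 * + k) (ℤₚ.pos-+ a d) ⟨
    (+ (a ℕ.+ d) - + a) + + 2 * + k ∎

InCH̃₂⁺-h·h : ∀ a b → InCH̃₂⁺ (h a · h b)
InCH̃₂⁺-h·h a b with ℕₚ.≤-total a b
... | inj₁ a≤b = subst (λ t → InCH̃₂⁺ (h a · h t)) (ℕₚ.m+[n∸m]≡n a≤b) (_ , h·h-clebsch-gordan a (b ℕ.∸ a))
... | inj₂ b≤a = InCH̃₂⁺-resp-≈ (·-comm (h a) (h b))
  (subst (λ t → InCH̃₂⁺ (h b · h t)) (ℕₚ.m+[n∸m]≡n b≤a) (_ , h·h-clebsch-gordan b (a ℕ.∸ b)))

InCH̃₂⁺-h·sumH : ∀ m ms → InCH̃₂⁺ (h m · sumH ms)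
InCH̃₂⁺-h·sumH m []        = [] , ·-zeroʳ (h m)
InCH̃₂⁺-h·sumH m (m′ ∷ ms) =
  InCH̃₂⁺-resp-≈ (·-distribˡ (h m) (h m′) (sumH ms)) (InCH̃₂⁺-⊕ (InCH̃₂⁺-h·h m m′) (InCH̃₂⁺-h·sumH m ms))

InCH̃₂⁺-sumH· : ∀ ms {y} → InCH̃₂⁺ y → InCH̃₂⁺ (sumH ms · y)
InCH̃₂⁺-sumH· []       y⁺              = [] , ≈-refl
InCH̃₂⁺-sumH· (m ∷ ms) {y} (ns , y≈ns) =
  InCH̃₂⁺-resp-≈ (·-distribʳ y (h m) (sumH ms))
    (InCH̃₂⁺-⊕ (InCH̃₂⁺-resp-≈ (·-cong (≈-refl {h m}) y≈ns) (InCH̃₂⁺-h·sumH m ns)) (InCH̃₂⁺-sumH· ms (ns , y≈ns)))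

InCH̃₂⁺-· : ∀ {x y} → InCH̃₂⁺ x → InCH̃₂⁺ y → InCH̃₂⁺ (x · y)
InCH̃₂⁺-· {y = y} (ms , x≈ms) y⁺ = InCH̃₂⁺-resp-≈ (·-cong x≈ms (≈-refl {y})) (InCH̃₂⁺-sumH· ms y⁺)

InCH̃₂⁺-G : ∀ n → InCH̃₂⁺ (G n)
InCH̃₂⁺-G zero    = InCH̃₂⁺-h 0
InCH̃₂⁺-G (suc n) = InCH̃₂⁺-· G⁺ (InCH̃₂⁺-· G⁺ (InCH̃₂⁺-· G⁺ (InCH̃₂⁺-h (2 ℕ.+ ρ n))))
  where G⁺ = InCH̃₂⁺-G n

InCH̃₂⁺-ẽ : ∀ n i → InCH̃₂⁺ (ẽ n i)
InCH̃₂⁺-ẽ n i with factorised n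
InCH̃₂⁺-ẽ n z  | e0≈ , _ , _   = InCH̃₂⁺-resp-≈ e0≈ (InCH̃₂⁺-· (InCH̃₂⁺-G n) (InCH̃₂⁺-h (2 ℕ.+ ρ n)))
InCH̃₂⁺-ẽ n p1 | _ , e1≈ , _   = InCH̃₂⁺-resp-≈ e1≈ (InCH̃₂⁺-· (InCH̃₂⁺-G n) (InCH̃₂⁺-h (1 ℕ.+ ρ n)))
InCH̃₂⁺-ẽ n m1 | _ , _ , em1≈ = InCH̃₂⁺-resp-≈ em1≈ (InCH̃₂⁺-· (InCH̃₂⁺-G n) (InCH̃₂⁺-h (1 ℕ.+ ρ n)))

indicator : ℤ → ℤ → ℤ
indicator a s = if does (a ℤ.≟ s) then + 1 else + 0

indicator-nonneg : ∀ a s → + 0 ≤ indicator a s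
indicator-nonneg a s with does (a ℤ.≟ s)
... | true  = ℤ.+≤+ ℕ.z≤n
... | false = ℤ.+≤+ ℕ.z≤n

indicator-+ : ∀ a s c → indicator a (s + c) ≡ indicator (a - c) s
indicator-+ a s c =
  cong (if_then + 1 else + 0) (does-⇔ (mk⇔ to from) (a ℤ.≟ s + c) (a - c ℤ.≟ s))
  where
  e₁ : ∀ s c → s + c - c ≡ s
  e₁ = solve-∀
  e₂ : ∀ a c → a - c + c ≡ a
  e₂ = solve-∀
  to : a ≡ s + c → a - c ≡ s
  to a≡ = trans (cong (_- c) a≡) (e₁ s c)
  from : a - c ≡ s → a ≡ s + c
  from a-c≡ = trans (sym (e₂ a c)) (cong (_+ c) a-c≡)

-- σ n δ is the difference of the indicators of ±(n+1), so at positive points it detects n.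
δ : Fun
δ s = indicator (+ 1) s - indicator -[1+ 0 ] s

σ-δ : ∀ n s → σ n δ s ≡ indicator (+ suc n) s - indicator -[1+ n ] s
σ-δ zero    s = refl
σ-δ (suc n) s = begin
  δ (s - + suc n) + σ n δ (s + + 1)
    ≡⟨ cong₂ _+_ (cong₂ _-_ (indicator-+ (+ 1) s _) (indicator-+ -[1+ 0 ] s _))
                 (trans (σ-δ n (s + + 1)) (cong₂ _-_ (indicator-+ (+ suc n) s (+ 1)) (indicator-+ -[1+ n ] s (+ 1)))) ⟩
  (indicator (+ suc (suc n)) s - indicator (+ n) s) + (indicator (+ n) s - indicator -[1+ suc (n ℕ.+ 0) ] s)
    ≡⟨ telescope (indicator (+ suc (suc n)) s) (indicator (+ n) s) _ ⟩
  indicator (+ suc (suc n)) s - indicator -[1+ suc (n ℕ.+ 0) ] s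
    ≡⟨ cong (λ k → indicator (+ suc (suc n)) s - indicator -[1+ suc k ] s) (ℕₚ.+-identityʳ n) ⟩
  indicator (+ suc (suc n)) s - indicator -[1+ suc n ] s ∎
  where
  open ≡-Reasoning
  telescope : ∀ a b c → (a - b) + (b - c) ≡ a - c
  telescope = solve-∀

σ-δ-pos : ∀ n m → σ n δ (+ suc m) ≡ (if n ℕ.≡ᵇ m then + 1 else + 0)
σ-δ-pos n m = trans (σ-δ n (+ suc m)) (ℤₚ.+-identityʳ _)

coeff-⟪⟫ : ∀ x m → coeff x m ≡ ⟪ x ⟫ δ (+ suc m)
coeff-⟪⟫ []            m = refl
coeff-⟪⟫ ((i , a) ∷ x) m rewrite σ-δ-pos i m | coeff-⟪⟫ x m with i ℕ.≡ᵇ m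
... | true  = cong (_+ ⟪ x ⟫ δ (+ suc m)) (sym (ℤₚ.*-identityʳ a))
... | false = sym (trans (cong (_+ ⟪ x ⟫ δ (+ suc m)) (ℤₚ.*-zeroʳ a)) (ℤₚ.+-identityˡ _))

⟦sumH⟧-δ-nonneg : ∀ ms m → + 0 ≤ ⟦ sumH ms ⟧ δ (+ suc m)
⟦sumH⟧-δ-nonneg []       m = ℤ.+≤+ ℕ.z≤n
⟦sumH⟧-δ-nonneg (k ∷ ms) m = ℤₚ.+-mono-≤ term-nonneg (⟦sumH⟧-δ-nonneg ms m)
  where
  term-nonneg : + 0 ≤ + 1 * σ k δ (+ suc m)
  term-nonneg = subst (+ 0 ≤_) (sym (trans (ℤₚ.*-identityˡ _) (σ-δ-pos k m)))
                      (indicator-nonneg (+ suc k) (+ suc m))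

InCH̃₂⁺⇒InCH₂⁺ : ∀ {g} → InCH̃₂⁺ g → InCH₂⁺ (L g)
InCH̃₂⁺⇒InCH₂⁺ {g} (ms , g≈ms) k = subst (+ 0 ≤_) (sym coeff≡) (⟦sumH⟧-δ-nonneg ms k)
  where
  open ≡-Reasoning
  coeff≡ : coeff (L g) k ≡ ⟦ sumH ms ⟧ δ (+ suc k)
  coeff≡ = begin
    coeff (L g) k           ≡⟨ coeff-⟪⟫ (L g) k ⟩
    ⟪ L g ⟫ δ (+ suc k)     ≡⟨ ⟪L⟫ g δ (+ suc k) ⟩
    ⟦ g ⟧ δ (+ suc k)       ≡⟨ at g≈ms δ (+ suc k) ⟩
    ⟦ sumH ms ⟧ δ (+ suc k) ∎

corollary1 : (n : ℕ) (i : Idx) → InCH₂⁺ (L (ẽ n i))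
corollary1 n i = InCH̃₂⁺⇒InCH₂⁺ (InCH̃₂⁺-ẽ n i)
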